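{- Let $B$ be a finite set of species, let $S=(W,H)$ be a species tree on $B$, let $T=(V,E)$ be a gene tree with leaf set $L$ ($|L|\ge 3$), let $\sigma:L\to B$ with $\sigma(L)=B$, and let $t:V\to\{\bullet,\square,\odot\}$ be an event labeling, where $(T,t,\sigma)$ satisfies condition (C). If $\mu:V\to W\cup H$ is a reconciliation map from $(T,t,\sigma)$ to $S$, then for all $x\in V$: (D1) $x\in L$ implies $\mu(x)=\sigma(x)$; (D2.a) $\mu(x)\in W$ implies $\mu(x)=\operatorname{lca}_S(\sigma(L(x)))$; (D2.b) $\mu(x)\in H$ implies $\operatorname{lca}_S(\sigma(L(x)))\prec_S\mu(x)$; (D3) for $x,y\in V$ with $x\prec_T y$: if $\mu(x),\mu(y)\in H$ then $\mu(x)\preceq_S\mu(y)$, and otherwise $\mu(x)\prec_S\mu(y)$.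
   Context: A phylogenetic tree $T=(V,E)$ on leaf set $L\subseteq V$ is a rooted tree with directed edges, root $\rho_T$ of indegree zero, and no vertex with indegree one and outdegree one. The ancestor order: $x\preceq_T y$ iff $y$ lies on the path from $x$ to the root; $x\prec_T y$ means $x\preceq_T y$ and $x\ne y$. For $x\in V$, $L(x)=\{y\in L: y\preceq_T x\}$. For nonempty $A\subseteq L$, $\operatorname{lca}_T(A)$ is the unique $\preceq_T$-minimal vertex $v$ with $a\preceq_T v$ for all $a\in A$. An edge from parent $u$ to child $v$ is written $[u,v]$. The order is extended to edges: for an edge $e=[u,v]$ and a vertex $x$, $x\prec e$ iff $x\preceq v$, and $e\prec x$ iff $u\preceq x$; for edges $e=[u,v]$, $f=[a,b]$, $e\preceq f$ iff $v\preceq b$. A species tree $S=(W,H)$ on a finite set $B$ is a phylogenetic tree on leaf set $B$ to which an extra vertex $\rho_S$ (the new root) and an extra edge $[\rho_S,\operatorname{lca}_S(B)]$ have been added. A gene tree is a phylogenetic tree $T=(V,E)$ with leaf set $L$; $\sigma:L\to B$ assigns to each gene its species, and for $Y\subseteq L$, $\sigma(Y)=\{\sigma(y):y\in Y\}$. The event labeling $t:V\to\{\bullet,\square,\odot\}$ satisfies $t(x)=\odot$ iff $x\in L$ (interior vertices are speciations $\bullet$ or duplications $\square$). Condition (C): if $t(z)=\bullet$ and $T',T''$ are subtrees of $T$ rooted at two distinct children of $z$, then $\sigma(L(T'))\cap\sigma(L(T''))=\emptyset$. A reconciliation map from $(T,t,\sigma)$ to $S$ is a map $\mu:V\to W\cup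 H$ such that for all $x\in V$: (i) if $t(x)=\odot$ then $\mu(x)=\sigma(x)$; (ii) if $t(x)=\bullet$ then $\mu(x)\in W\setminus B$; (iii) if $t(x)=\square$ then $\mu(x)\in H$; (iv) for $x,y\in V$ with $x\prec_T y$: if $t(x)=t(y)=\square$ then $\mu(x)\preceq_S\mu(y)$, and if $t(x)=t(y)=\bullet$ or $t(x)\ne t(y)$ then $\mu(x)\prec_S\mu(y)$ (in the extended order); (v) if $t(x)=\bullet$ then $\mu(x)=\operatorname{lca}_S(\sigma(L(x)))$. -}

module Defs where

open import Data.Nat using (ℕ)
open import Data.Fin using (Fin)
open import Data.Product using (Σ; ∃; ∃-syntax; _×_; _,_)
open import Relation.Nullary using (¬_)
open import Data.Empty using (⊥)
open import Relation.Binary.PropositionalEquality using (_≡_; _≢_)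
open import Relation.Binary.Construct.Closure.ReflexiveTransitive using (Star)

-- Every non-root vertex v has a unique parent
-- 'parent v', giving the directed edge [parent v , v]; the value of
-- 'parent root' is irrelevant (the root has indegree zero).

record RootedTree : Set where
  field
    n      : ℕ
    root   : Fin n
    parent : Fin n → Fin n

open RootedTree public

Vtx : RootedTree → Set
Vtx T = Fin (n T)

Up : (T : RootedTree) → Vtx T → Vtx T → Set
Up T x y = (x ≢ root T) × (parent T x ≡ y)

_⊢_⪯_ : (T : RootedTree) → Vtx T → Vtx T → Set
T ⊢ x ⪯ y = Star (Up T) x y

_⊢_≺_ : (T : RootedTree) → Vtx T → Vtx T → Set
T ⊢ x ≺ y = (T ⊢ x ⪯ y) × (x ≢ y)

Child : (T : RootedTree) → Vtx T → Vtx T → Set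
Child T u v = Up T v u

Leaf : (T : RootedTree) → Vtx T → Set
Leaf T x = ∀ v → ¬ Child T x v

IsRootedTree : RootedTree → Set
IsRootedTree T = ∀ v → T ⊢ v ⪯ root T

-- no vertex with indegree one and outdegree one: every non-root vertex
-- that has a child has a second, distinct child
NoDeg2 : RootedTree → Set
NoDeg2 T = ∀ v → v ≢ root T → ∀ c → Child T v c →
           ∃[ c' ] (Child T v c' × c' ≢ c)

IsPhylogenetic : RootedTree → Set
IsPhylogenetic T = IsRootedTree T × NoDeg2 T

-- species tree: a phylogenetic tree on B (= its leaves) with an extra
-- root ρ_S and extra edge [ρ_S , lca(B)].  Equivalently: a rooted tree
-- whose root has exactly one child and in which every non-root vertex
-- has outdegree 0 or ≥ 2.
IsSpeciesTree : RootedTree → Set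
IsSpeciesTree S =
  IsRootedTree S × NoDeg2 S ×
  (∃[ c ] (Child S (root S) c × (∀ c' → Child S (root S) c' → c' ≡ c)))

UpperBound : (T : RootedTree) → (Vtx T → Set) → Vtx T → Set
UpperBound T A v = ∀ a → A a → T ⊢ a ⪯ v

IsLca : (T : RootedTree) → (Vtx T → Set) → Vtx T → Set
IsLca T A v = UpperBound T A v × (∀ w → UpperBound T A w → T ⊢ w ⪯ v → w ≡ v)

-- Vertices and edges of S (W ∪ H).  An edge [parent v , v] is named by
-- its lower endpoint v ≠ root.

data Loc (S : RootedTree) : Set where
  vtx : Vtx S → Loc S
  edg : (v : Vtx S) → v ≢ root S → Loc S

InW : {S : RootedTree} → Loc S → Set
InW {S} l = ∃[ w ] (l ≡ vtx w)

InH : {S : RootedTree} → Loc S → Set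
InH {S} l = ∃[ v ] ∃[ p ] (l ≡ edg v p)

_⊢_≺ᴸ_ : (S : RootedTree) → Loc S → Loc S → Set
S ⊢ vtx a   ≺ᴸ vtx b   = S ⊢ a ≺ b
S ⊢ vtx a   ≺ᴸ edg v _ = S ⊢ a ⪯ v
S ⊢ edg v _ ≺ᴸ vtx b   = S ⊢ parent S v ⪯ b
S ⊢ edg v _ ≺ᴸ edg w _ = S ⊢ v ≺ w

_⊢_⪯ᴸ_ : (S : RootedTree) → Loc S → Loc S → Set
S ⊢ vtx a   ⪯ᴸ vtx b   = S ⊢ a ⪯ b
S ⊢ vtx a   ⪯ᴸ edg v _ = S ⊢ a ⪯ v
S ⊢ edg v _ ⪯ᴸ vtx b   = S ⊢ parent S v ⪯ b
S ⊢ edg v _ ⪯ᴸ edg w _ = S ⊢ v ⪯ w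

data Event : Set where
  spec dup leafE : Event

SpeciesMap : RootedTree → RootedTree → Set
SpeciesMap T S = (x : Vtx T) → Leaf T x → Vtx S

σL : (T S : RootedTree) → SpeciesMap T S → Vtx T → Vtx S → Set
σL T S σ x b = ∃[ y ] Σ (Leaf T y) (λ p → (T ⊢ y ⪯ x) × (σ y p ≡ b))

SpeciesMapOK : (T S : RootedTree) → SpeciesMap T S → Set
SpeciesMapOK T S σ =
  (∀ x p → Leaf S (σ x p)) ×
  (∀ b → Leaf S b → ∃[ x ] Σ (Leaf T x) (λ p → σ x p ≡ b))

EventLabeling : (T : RootedTree) → (Vtx T → Event) → Set
EventLabeling T t = ∀ x → (t x ≡ leafE → Leaf T x) × (Leaf T x → t x ≡ leafE)

AtLeast3Leaves : RootedTree → Set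
AtLeast3Leaves T = ∃[ a ] ∃[ b ] ∃[ c ]
  (Leaf T a × Leaf T b × Leaf T c × a ≢ b × a ≢ c × b ≢ c)

CondC : (T S : RootedTree) → (Vtx T → Event) → SpeciesMap T S → Set
CondC T S t σ = ∀ z → t z ≡ spec → ∀ c₁ c₂ → Child T z c₁ → Child T z c₂ →
  c₁ ≢ c₂ → ∀ b → σL T S σ c₁ b → σL T S σ c₂ b → ⊥

IsReconciliation : (T S : RootedTree) → (t : Vtx T → Event) →
  (σ : SpeciesMap T S) → (μ : Vtx T → Loc S) → Set
IsReconciliation T S t σ μ =
  (∀ x → t x ≡ leafE → (p : Leaf T x) → μ x ≡ vtx (σ x p)) ×
  (∀ x → t x ≡ spec → ∃[ w ] (μ x ≡ vtx w × ¬ Leaf S w)) ×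
  (∀ x → t x ≡ dup → InH (μ x)) ×
  (∀ x y → T ⊢ x ≺ y →
     (t x ≡ dup → t y ≡ dup → S ⊢ μ x ⪯ᴸ μ y) ×
     (t x ≡ spec → t y ≡ spec → S ⊢ μ x ≺ᴸ μ y) ×
     (t x ≢ t y → S ⊢ μ x ≺ᴸ μ y)) ×
  (∀ x → t x ≡ spec → ∃[ w ] (μ x ≡ vtx w × IsLca S (σL T S σ x) w))

-- The only substantial clause is (D2.b).  If x is a duplication mapped to the edge above v,
-- axiom (iv) applied to each leaf y below x (a leaf and a duplication carry different
-- events) gives σ(y) ⪯ v, so v bounds σ(L(x)); climbing from one species of σ(L(x))
-- towards v, the first upper bound met is lca σ(L(x)), and it lies below v.  (D1), (D2.a)
-- and (D3) are the axioms (i), (v) and (iv) sorted by whether μ lands on a vertex or an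
-- edge, which is decided by the event.
module Submission where

open import Defs
open import Data.Product using (∃-syntax; _×_; _,_; proj₁; proj₂)
open import Data.Empty using (⊥-elim)
open import Data.Fin.Properties using (_≟_; all?; any?)
open import Data.Fin.Induction using (po-wellFounded)
open import Induction.WellFounded using (WellFounded; Acc; acc)
open import Relation.Nullary using (¬_; Dec; yes; no; ¬?)
open import Relation.Nullary.Decidable using (map′; _×-dec_)
open import Relation.Unary using (Decidable)
open import Relation.Binary.Structures using (IsPartialOrder)
open import Relation.Binary.PropositionalEquality
  using (_≡_; _≢_; refl; sym; trans; subst; subst₂; isEquivalence)
open import Relation.Binary.Construct.Closure.ReflexiveTransitive using (ε; _◅_; _◅◅_)

module AncestorOrder (T : RootedTree) (rooted : IsRootedTree T) where

  up-functional : ∀ {x a b} → Up T x a → Up T x b → a ≡ b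
  up-functional (_ , refl) (_ , refl) = refl

  ⪯-step : ∀ {x a y} → Up T x a → T ⊢ x ⪯ y → x ≢ y → T ⊢ a ⪯ y
  ⪯-step _ ε x≢y = ⊥-elim (x≢y refl)
  ⪯-step {y = y} s (s′ ◅ a⪯y) _ = subst (λ z → T ⊢ z ⪯ y) (up-functional s′ s) a⪯y

  root-⪯⇒≡ : ∀ {y} → T ⊢ root T ⪯ y → root T ≡ y
  root-⪯⇒≡ ε = refl
  root-⪯⇒≡ ((r≢r , _) ◅ _) = ⊥-elim (r≢r refl)

  private
    ⪯-dec-along : ∀ {x} → T ⊢ x ⪯ root T → ∀ y → Dec (T ⊢ x ⪯ y)
    ⪯-dec-along ε y = map′ (λ { refl → ε }) root-⪯⇒≡ (root T ≟ y)
    ⪯-dec-along {x} (s ◅ a⪯r) y with x ≟ y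
    ... | yes refl = yes ε
    ... | no x≢y = map′ (s ◅_) (λ x⪯y → ⪯-step s x⪯y x≢y) (⪯-dec-along a⪯r y)

  _⪯?_ : ∀ x y → Dec (T ⊢ x ⪯ y)
  x ⪯? y = ⪯-dec-along (rooted x) y

  -- Induction on the path from w to the root: a cycle through w would also pass
  -- through the parent of w, which is one step closer to the root.
  up-acyclic : ∀ {w a} → T ⊢ w ⪯ root T → Up T w a → ¬ (T ⊢ a ⪯ w)
  up-acyclic ε (r≢r , _) _ = r≢r refl
  up-acyclic (s ◅ a⪯r) u a⪯w with up-functional s u
  up-acyclic (s ◅ a⪯r) u ε         | refl = up-acyclic a⪯r u ε
  up-acyclic (s ◅ a⪯r) u (s′ ◅ a′⪯w) | refl = up-acyclic a⪯r s′ (a′⪯w ◅◅ (u ◅ ε))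

  ⪯-antisym : ∀ {x y} → T ⊢ x ⪯ y → T ⊢ y ⪯ x → x ≡ y
  ⪯-antisym ε _ = refl
  ⪯-antisym {x} (s ◅ a⪯y) y⪯x = ⊥-elim (up-acyclic (rooted x) s (a⪯y ◅◅ y⪯x))

  ⪯-isPartialOrder : IsPartialOrder _≡_ (T ⊢_⪯_)
  ⪯-isPartialOrder = record
    { isPreorder = record
      { isEquivalence = isEquivalence
      ; reflexive     = λ { refl → ε }
      ; trans         = _◅◅_
      }
    ; antisym = ⪯-antisym
    }

  ≺-wellFounded : WellFounded (T ⊢_≺_)
  ≺-wellFounded = po-wellFounded ⪯-isPartialOrder

  child-≺ : ∀ {x c} → Child T x c → T ⊢ c ≺ x
  child-≺ {x} u = u ◅ ε , λ { refl → up-acyclic (rooted x) u ε }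

  Child? : ∀ x c → Dec (Child T x c)
  Child? x c = ¬? (c ≟ root T) ×-dec (parent T c ≟ x)

  Leaf? : Decidable (Leaf T)
  Leaf? x = all? (λ c → ¬? (Child? x c))

  up-⪯⇒∃child : ∀ {y a x} → Up T y a → T ⊢ a ⪯ x → ∃[ c ] Child T x c
  up-⪯⇒∃child s ε = _ , s
  up-⪯⇒∃child _ (s ◅ a⪯x) = up-⪯⇒∃child s a⪯x

  leaf-⪯⇒≡ : ∀ {x y} → Leaf T x → T ⊢ y ⪯ x → y ≡ x
  leaf-⪯⇒≡ _ ε = refl
  leaf-⪯⇒≡ leaf (s ◅ a⪯x) = ⊥-elim (leaf _ (proj₂ (up-⪯⇒∃child s a⪯x)))

  leaf-below : ∀ x → ∃[ y ] (Leaf T y × T ⊢ y ⪯ x)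
  leaf-below x = descend (≺-wellFounded x)
    where
    descend : ∀ {x} → Acc (T ⊢_≺_) x → ∃[ y ] (Leaf T y × T ⊢ y ⪯ x)
    descend {x} (acc below) with any? (Child? x)
    ... | no ¬child = x , (λ c u → ¬child (c , u)) , ε
    ... | yes (c , u) with descend (below (child-≺ u))
    ...   | y , leaf , y⪯c = y , leaf , y⪯c ◅◅ (u ◅ ε)

  -- All upper bounds of A lie above a ∈ A, hence on the path from a to the root:
  -- the first upper bound met when climbing that path is the lca.
  lca-below : (A : Vtx T → Set) → Decidable (UpperBound T A) →
              ∀ {a v} → A a → UpperBound T A v → ∃[ u ] (IsLca T A u × T ⊢ u ⪯ v)
  lca-below A upperBound? {a} {v} a∈A ub-v = climb (ub-v a a∈A) (λ w ub-w → ub-w a a∈A)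
    where
    climb : ∀ {c} → T ⊢ c ⪯ v → (∀ w → UpperBound T A w → T ⊢ c ⪯ w) →
            ∃[ u ] (IsLca T A u × T ⊢ u ⪯ v)
    climb {c} c⪯v below with upperBound? c
    ... | yes ub-c = c , (ub-c , λ w ub-w w⪯c → ⪯-antisym w⪯c (below w ub-w)) , c⪯v
    ... | no ¬ub-c with c⪯v
    ...   | ε = ⊥-elim (¬ub-c ub-v)
    ...   | s ◅ a⪯v = climb a⪯v (λ w ub-w → ⪯-step s (below w ub-w) λ { refl → ¬ub-c ub-w })

  upperBound-member⇒lca : ∀ {A w} → A w → UpperBound T A w → IsLca T A w
  upperBound-member⇒lca w∈A ub-w = ub-w , λ w′ ub-w′ w′⪯w → ⪯-antisym w′⪯w (ub-w′ _ w∈A)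

_≟ᴱ_ : ∀ (e e′ : Event) → Dec (e ≡ e′)
spec  ≟ᴱ spec  = yes refl
dup   ≟ᴱ dup   = yes refl
leafE ≟ᴱ leafE = yes refl
spec  ≟ᴱ dup   = no λ ()
spec  ≟ᴱ leafE = no λ ()
dup   ≟ᴱ spec  = no λ ()
dup   ≟ᴱ leafE = no λ ()
leafE ≟ᴱ spec  = no λ ()
leafE ≟ᴱ dup   = no λ ()

vtx-injective : ∀ {S} {a b : Vtx S} → vtx {S} a ≡ vtx b → a ≡ b
vtx-injective refl = refl

vtx∉H : ∀ {S} {l : Loc S} {w} → l ≡ vtx w → ¬ InH l
vtx∉H refl (_ , _ , ())

module Reconciled
  (S T : RootedTree) (rootedS : IsRootedTree S) (rootedT : IsRootedTree T)
  (σ : SpeciesMap T S) (t : Vtx T → Event) (labeling : EventLabeling T t)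
  (μ : Vtx T → Loc S)
  (μ-leaf : ∀ x → t x ≡ leafE → (p : Leaf T x) → μ x ≡ vtx (σ x p))
  (μ-spec : ∀ x → t x ≡ spec → ∃[ w ] (μ x ≡ vtx w × ¬ Leaf S w))
  (μ-dup : ∀ x → t x ≡ dup → InH (μ x))
  (μ-mono : ∀ x y → T ⊢ x ≺ y →
     (t x ≡ dup → t y ≡ dup → S ⊢ μ x ⪯ᴸ μ y) ×
     (t x ≡ spec → t y ≡ spec → S ⊢ μ x ≺ᴸ μ y) ×
     (t x ≢ t y → S ⊢ μ x ≺ᴸ μ y))
  (μ-lca : ∀ x → t x ≡ spec → ∃[ w ] (μ x ≡ vtx w × IsLca S (σL T S σ x) w))
  where

  module ST = AncestorOrder S rootedS
  module TT = AncestorOrder T rootedT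

  μ-on-leaf : ∀ x → (p : Leaf T x) → μ x ≡ vtx (σ x p)
  μ-on-leaf x p = μ-leaf x (proj₂ (labeling x) p) p

  -- σ may depend on the leafhood proof; μ does not, and μ determines σ on leaves.
  σ-irrelevant : ∀ y (p p′ : Leaf T y) → σ y p ≡ σ y p′
  σ-irrelevant y p p′ = vtx-injective (trans (sym (μ-on-leaf y p)) (μ-on-leaf y p′))

  μ∈H⇒dup : ∀ x → InH (μ x) → t x ≡ dup
  μ∈H⇒dup x μx∈H with t x in tx
  ... | leafE = ⊥-elim (vtx∉H (μ-on-leaf x (proj₁ (labeling x) tx)) μx∈H)
  ... | spec = ⊥-elim (vtx∉H (proj₁ (proj₂ (μ-spec x tx))) μx∈H)
  ... | dup = refl

  upperBound-σL? : ∀ x → Decidable (UpperBound S (σL T S σ x))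
  upperBound-σL? x c = map′
    (λ { bounded b (y , p , y⪯x , refl) → bounded y p y⪯x })
    (λ ub y p y⪯x → ub (σ y p) (y , p , y⪯x , refl))
    (all? bounded?)
    where
    bounded? : ∀ y → Dec (∀ (p : Leaf T y) → T ⊢ y ⪯ x → S ⊢ σ y p ⪯ c)
    bounded? y with TT.Leaf? y
    ... | no ¬leaf = yes λ p _ → ⊥-elim (¬leaf p)
    ... | yes p with y TT.⪯? x
    ...   | no y⋠x = yes λ _ y⪯x → ⊥-elim (y⋠x y⪯x)
    ...   | yes y⪯x = map′
              (λ σy⪯c p′ _ → subst (λ b → S ⊢ b ⪯ c) (σ-irrelevant y p p′) σy⪯c)
              (λ bounded → bounded p y⪯x)
              (σ y p ST.⪯? c)

  dup-edge-upperBound : ∀ x v (q : v ≢ root S) → t x ≡ dup → μ x ≡ edg v q →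
                        UpperBound S (σL T S σ x) v
  dup-edge-upperBound x v q tx μx _ (y , p , y⪯x , refl) =
    subst₂ (S ⊢_≺ᴸ_) (μ-on-leaf y p) μx (proj₂ (proj₂ (μ-mono y x (y⪯x , y≢x))) ty≢tx)
    where
    ty : t y ≡ leafE
    ty = proj₂ (labeling y) p
    ty≢tx : t y ≢ t x
    ty≢tx eq with trans (sym ty) (trans eq tx)
    ... | ()
    y≢x : y ≢ x
    y≢x refl = ty≢tx refl

  μ∈W⇒lca : ∀ x w → μ x ≡ vtx w → IsLca S (σL T S σ x) w
  μ∈W⇒lca x w μx with t x in tx
  ... | leafE = ST.upperBound-member⇒lca (x , p , ε , σx) upper
    where
    p : Leaf T x
    p = proj₁ (labeling x) tx
    σx : σ x p ≡ w
    σx = vtx-injective (trans (sym (μ-on-leaf x p)) μx)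
    upper : UpperBound S (σL T S σ x) w
    upper _ (y , p′ , y⪯x , refl) with TT.leaf-⪯⇒≡ p y⪯x
    ... | refl = subst (λ b → S ⊢ σ y p′ ⪯ b) (trans (σ-irrelevant y p′ p) σx) ε
  ... | spec with μ-lca x tx
  ...   | _ , μx′ , lca = subst (IsLca S (σL T S σ x)) (vtx-injective (trans (sym μx′) μx)) lca
  μ∈W⇒lca x w μx | dup = ⊥-elim (vtx∉H μx (μ-dup x tx))

  μ∈H⇒lca-below : ∀ x v (q : v ≢ root S) → μ x ≡ edg v q →
                  ∃[ u ] (IsLca S (σL T S σ x) u × S ⊢ vtx u ≺ᴸ edg v q)
  μ∈H⇒lca-below x v q μx with TT.leaf-below x
  ... | y , p , y⪯x =
    ST.lca-below (σL T S σ x) (upperBound-σL? x) (y , p , y⪯x , refl)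
      (dup-edge-upperBound x v q (μ∈H⇒dup x (v , q , μx)) μx)

  μ-monotone : ∀ x y → T ⊢ x ≺ y →
               ((InH (μ x) × InH (μ y)) → S ⊢ μ x ⪯ᴸ μ y) ×
               (¬ (InH (μ x) × InH (μ y)) → S ⊢ μ x ≺ᴸ μ y)
  μ-monotone x y x≺y@(x⪯y , x≢y) = (λ (hx , hy) → dups (μ∈H⇒dup x hx) (μ∈H⇒dup y hy)) , strict
    where
    dups : t x ≡ dup → t y ≡ dup → S ⊢ μ x ⪯ᴸ μ y
    dups = proj₁ (μ-mono x y x≺y)
    specs : t x ≡ spec → t y ≡ spec → S ⊢ μ x ≺ᴸ μ y
    specs = proj₁ (proj₂ (μ-mono x y x≺y))
    differ : t x ≢ t y → S ⊢ μ x ≺ᴸ μ y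
    differ = proj₂ (proj₂ (μ-mono x y x≺y))
    strict : ¬ (InH (μ x) × InH (μ y)) → S ⊢ μ x ≺ᴸ μ y
    strict ¬both with t x ≟ᴱ t y
    ... | no tx≢ty = differ tx≢ty
    ... | yes tx≡ty with t y in ty
    ...   | spec = specs tx≡ty ty
    ...   | dup = ⊥-elim (¬both (μ-dup x tx≡ty , μ-dup y ty))
    ...   | leafE = ⊥-elim (x≢y (TT.leaf-⪯⇒≡ (proj₁ (labeling y) ty) x⪯y))

lemma1 : (S T : RootedTree) → IsSpeciesTree S → IsPhylogenetic T →
         AtLeast3Leaves T →
         (σ : SpeciesMap T S) → SpeciesMapOK T S σ →
         (t : Vtx T → Event) → EventLabeling T t → CondC T S t σ →
         (μ : Vtx T → Loc S) → IsReconciliation T S t σ μ →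
         (∀ x → (p : Leaf T x) → μ x ≡ vtx (σ x p)) ×
         (∀ x w → μ x ≡ vtx w → IsLca S (σL T S σ x) w) ×
         (∀ x v (q : v ≢ root S) → μ x ≡ edg v q →
            ∃[ u ] (IsLca S (σL T S σ x) u × S ⊢ vtx u ≺ᴸ edg v q)) ×
         (∀ x y → T ⊢ x ≺ y →
            ((InH (μ x) × InH (μ y)) → S ⊢ μ x ⪯ᴸ μ y) ×
            (¬ (InH (μ x) × InH (μ y)) → S ⊢ μ x ≺ᴸ μ y))
lemma1 S T (rootedS , _) (rootedT , _) _ σ _ t labeling _ μ
       (μ-leaf , μ-spec , μ-dup , μ-mono , μ-lca) =
  μ-on-leaf , μ∈W⇒lca , μ∈H⇒lca-below , μ-monotone
  where
  open Reconciled S T rootedS rootedT σ t labeling μ μ-leaf μ-spec μ-dup μ-mono μ-lca
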